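{- Let $m\ge 2$ be an integer. There are unique rational numbers $c_{m2},\dots,c_{mm}$ such that $n^m=\sum_{k=2}^{m} c_{mk}\,\psi_k(n)$ for all $n\in\mathbb{N}$. With these coefficients, for every integer $a\ge 1$ and every $n\in\mathbb{N}$, \[ S^{(a)}_m(n)=\sum_{k=2}^{m} c_{mk}\,\psi^{(a)}_k(n), \] where \[ S^{(a)}_m(n)=\sum_{\nu_a=1}^{n}\sum_{\nu_{a-1}=1}^{\nu_a}\cdots\sum_{\nu_1=1}^{\nu_2}\nu_1^m \] is the $a$-fold iterated power sum.
   Context: For integers $a,b\ge 0$ let $B_{a,b}=\frac{(a+b)!}{a!\,b!}$. For $m,n\in\mathbb{N}=\{1,2,\dots\}$ define $\psi_m(n)=n+(m-1)(n-1)B_{m-1,n-1}$. This is a polynomial in $n$, since $(m-1)(n-1)B_{m-1,n-1}=\frac{1}{(m-2)!}(n-1)n(n+1)\cdots(n+m-2)$ for $m\ge2$. Set $\psi^{(0)}_m=\psi_m$, and for $a\ge1$ define $\psi^{(a)}_m(n)=\sum_{\nu=1}^n \psi^{(a-1)}_m(\nu)$. -}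

module Defs where

open import Data.Nat using (ℕ; zero; suc; _+_; _*_; _∸_; _^_; _≤_)
open import Relation.Binary.PropositionalEquality using (_≡_)
open import Data.Nat.Combinatorics using (_C_)
open import Data.Integer using (+_)
open import Data.Rational using (ℚ; _/_; 0ℚ) renaming (_+_ to _+ℚ_; _*_ to _*ℚ_)

B : ℕ → ℕ → ℕ
B a b = (a + b) C a

ψ : ℕ → ℕ → ℕ
ψ m n = n + (m ∸ 1) * (n ∸ 1) * B (m ∸ 1) (n ∸ 1)

sumTo : (ℕ → ℕ) → ℕ → ℕ
sumTo f zero = 0
sumTo f (suc n) = sumTo f n + f (suc n)

ψIter : ℕ → ℕ → ℕ → ℕ
ψIter zero m n = ψ m n
ψIter (suc a) m n = sumTo (ψIter a m) n

S : ℕ → ℕ → ℕ → ℕ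
S zero m n = n ^ m
S (suc a) m n = sumTo (S a m) n

toℚ : ℕ → ℚ
toℚ n = + n / 1

-- Σ_{k=2}^{m} f k  (empty if m < 2)
sumℚ : ℕ → (ℕ → ℚ) → ℚ
sumℚ zero f = 0ℚ
sumℚ (suc j) f = sumℚ j f +ℚ f j

Σ₂ : ℕ → (ℕ → ℚ) → ℚ
Σ₂ m f = sumℚ (m ∸ 1) (λ j → f (2 + j))

Represents : ℕ → (ℕ → ℚ) → Set
Represents m c = ∀ n → 1 ≤ n → toℚ (n ^ m) ≡ Σ₂ m (λ k → c k *ℚ toℚ (ψ k n))

module Submission where

-- From (n + k - 1) ψ_k(n) = n² + (k - 1) ψ_{k+1}(n) and ψ_2(n) = n² one gets
-- n ψ_k = ψ_2 + (k - 1)(ψ_{k+1} - ψ_k), so summation by parts turns n · Σ_{k≤m} c_k ψ_k into a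
-- combination of ψ_2, …, ψ_{m+1}; induction on m gives the coefficients.
-- For uniqueness, ψ_k(t + 1) = 1 + t + k(k - 1) C(t + k - 1, k), and the functions t ↦ C(t + i - 1, i)
-- are linearly independent because taking forward differences shifts them down one step (Pascal).
-- The iterated identity follows from the case a = 0, since the iterated sums on both sides are
-- obtained by applying the same linear summation operator a times.

open import Defs
open import Data.Nat.Base as ℕ using (ℕ; zero; suc; _≤_; _<_; z≤n; s≤s)
import Data.Nat.Properties as ℕ
open import Data.Nat.Combinatorics using (_C_; nC1≡n; nCk+nC[k+1]≡[n+1]C[k+1])
open import Data.Nat.Tactic.RingSolver using (solve-∀)
import Data.Nat.Coprimality as Coprimality
import Data.Integer.Base as ℤ
import Data.Integer.Properties as ℤ
open import Data.Rational as ℚ using (ℚ; mkℚ; 0ℚ; 1ℚ) renaming (_*_ to _*ℚ_)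
import Data.Rational.Properties as ℚ
open import Data.Rational.Solver using (module +-*-Solver)
open import Algebra.Properties.CommutativeSemigroup ℕ.*-commutativeSemigroup using (x∙yz≈yx∙z)
open import Algebra.Properties.Group ℚ.+-0-group using (x∙y⁻¹≈ε⇒x≈y)
open import Data.Product using (∃; _×_; _,_)
open import Data.Sum using (inj₁; inj₂)
open import Relation.Binary.PropositionalEquality
  using (_≡_; refl; sym; trans; cong; cong₂; module ≡-Reasoning)

module _ where
  open import Data.Nat.Base using (_+_; _*_)
  open ≡-Reasoning

  [1+k]*[1+n]C[1+k]≡[1+n]*nCk : ∀ n k → suc k * (suc n C suc k) ≡ suc n * (n C k)
  [1+k]*[1+n]C[1+k]≡[1+n]*nCk zero    zero    = refl
  [1+k]*[1+n]C[1+k]≡[1+n]*nCk zero    (suc k) = ℕ.*-zeroʳ (suc (suc k))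
  [1+k]*[1+n]C[1+k]≡[1+n]*nCk (suc n) zero    =
    trans (ℕ.*-identityˡ (suc (suc n) C 1)) (trans (nC1≡n (suc (suc n))) (sym (ℕ.*-identityʳ (suc (suc n)))))
  [1+k]*[1+n]C[1+k]≡[1+n]*nCk (suc n) (suc k) = begin
    suc (suc k) * (suc (suc n) C suc (suc k))
      ≡⟨ cong (suc (suc k) *_) (nCk+nC[k+1]≡[n+1]C[k+1] (suc n) (suc k)) ⟨
    suc (suc k) * (a + b)
      ≡⟨ expand k a b ⟩
    a + suc k * a + suc (suc k) * b
      ≡⟨ cong₂ (λ x y → a + x + y) ([1+k]*[1+n]C[1+k]≡[1+n]*nCk n k) ([1+k]*[1+n]C[1+k]≡[1+n]*nCk n (suc k)) ⟩
    a + suc n * (n C k) + suc n * (n C suc k)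
      ≡⟨ collect a n (n C k) (n C suc k) ⟩
    a + suc n * (n C k + n C suc k)
      ≡⟨ cong (λ x → a + suc n * x) (nCk+nC[k+1]≡[n+1]C[k+1] n k) ⟩
    suc (suc n) * a
      ∎
    where
    a = suc n C suc k
    b = suc n C suc (suc k)
    expand : ∀ k a b → suc (suc k) * (a + b) ≡ a + suc k * a + suc (suc k) * b
    expand = solve-∀
    collect : ∀ a n x y → a + suc n * x + suc n * y ≡ a + suc n * (x + y)
    collect = solve-∀

  [1+k]*[t+k]C[1+k]≡t*[t+k]Ck : ∀ t k → suc k * ((t + k) C suc k) ≡ t * ((t + k) C k)
  [1+k]*[t+k]C[1+k]≡t*[t+k]Ck t k = ℕ.+-cancelˡ-≡ (suc k * x) _ _ (begin
    suc k * x + suc k * y         ≡⟨ ℕ.*-distribˡ-+ (suc k) x y ⟨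
    suc k * (x + y)               ≡⟨ cong (suc k *_) (nCk+nC[k+1]≡[n+1]C[k+1] (t + k) k) ⟩
    suc k * (suc (t + k) C suc k) ≡⟨ [1+k]*[1+n]C[1+k]≡[1+n]*nCk (t + k) k ⟩
    suc (t + k) * x               ≡⟨ split t k x ⟩
    suc k * x + t * x             ∎)
    where
    x = (t + k) C k
    y = (t + k) C suc k
    split : ∀ t k x → suc (t + k) * x ≡ suc k * x + t * x
    split = solve-∀

  -- multichoose t i = C(t + i - 1, i), written so that no truncated subtraction occurs.
  multichoose : ℕ → ℕ → ℕ
  multichoose t zero    = 1
  multichoose t (suc i) = (t + i) C suc i

  multichoose-pascal : ∀ t i → multichoose (suc t) (suc i) ≡ multichoose t (suc i) + multichoose (suc t) i
  multichoose-pascal t i = begin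
    suc (t + i) C suc i                           ≡⟨ nCk+nC[k+1]≡[n+1]C[k+1] (t + i) i ⟨
    (t + i) C i + (t + i) C suc i                 ≡⟨ ℕ.+-comm ((t + i) C i) _ ⟩
    (t + i) C suc i + (t + i) C i                 ≡⟨ cong ((t + i) C suc i +_) (shift i) ⟩
    multichoose t (suc i) + multichoose (suc t) i ∎
    where
    shift : ∀ i → (t + i) C i ≡ multichoose (suc t) i
    shift zero    = refl
    shift (suc i) = cong (_C suc i) (ℕ.+-suc t i)

  ψ-two : ∀ t → ψ 2 (suc t) ≡ suc t * suc t
  ψ-two t = trans (cong (λ x → suc t + 1 * t * x) (nC1≡n (suc t))) (square t)
    where
    square : ∀ t → suc t + 1 * t * suc t ≡ suc t * suc t
    square = solve-∀

  ψ-recurrence : ∀ j t → (suc t + j) * ψ (suc j) (suc t) ≡ suc t * suc t + j * ψ (suc (suc j)) (suc t)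
  ψ-recurrence j t = begin
    (suc t + j) * (suc t + j * t * x)
      ≡⟨ expand t j x ⟩
    suc t * suc t + j * (suc t + t * (suc (j + t) * x))
      ≡⟨ cong (λ z → suc t * suc t + j * (suc t + t * z)) ([1+k]*[1+n]C[1+k]≡[1+n]*nCk (j + t) j) ⟨
    suc t * suc t + j * (suc t + t * (suc j * y))
      ≡⟨ cong (λ z → suc t * suc t + j * (suc t + z)) (x∙yz≈yx∙z t (suc j) y) ⟩
    suc t * suc t + j * (suc t + suc j * t * y)
      ∎
    where
    x = (j + t) C j
    y = suc (j + t) C suc j
    expand : ∀ t j x → (suc t + j) * (suc t + j * t * x) ≡ suc t * suc t + j * (suc t + t * (suc (j + t) * x))
    expand = solve-∀

  ψ-multichoose : ∀ j t → ψ (suc j) (suc t) ≡ suc t + suc j * j * multichoose t (suc j)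
  ψ-multichoose j t = begin
    suc t + j * t * ((j + t) C j)             ≡⟨ cong (λ z → suc t + j * t * (z C j)) (ℕ.+-comm j t) ⟩
    suc t + j * t * ((t + j) C j)             ≡⟨ cong (suc t +_) (ℕ.*-assoc j t _) ⟩
    suc t + j * (t * ((t + j) C j))           ≡⟨ cong (λ z → suc t + j * z) ([1+k]*[t+k]C[1+k]≡t*[t+k]Ck t j) ⟨
    suc t + j * (suc j * ((t + j) C suc j))   ≡⟨ cong (suc t +_) (x∙yz≈yx∙z j (suc j) _) ⟩
    suc t + suc j * j * multichoose t (suc j) ∎

open import Data.Rational using (_+_; _*_; _-_)
open +-*-Solver using (solve; _:+_; _:*_; _:-_; _:=_; con)
open ≡-Reasoning

toℚ≡mkℚ : ∀ n → toℚ n ≡ mkℚ (ℤ.+ n) 0 (Coprimality.sym (Coprimality.1-coprimeTo n))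
toℚ≡mkℚ n = ℚ.normalize-coprime _

toℚ-homo-+ : ∀ m n → toℚ (m ℕ.+ n) ≡ toℚ m + toℚ n
toℚ-homo-+ m n rewrite toℚ≡mkℚ m | toℚ≡mkℚ n =
  cong (λ x → x ℚ./ 1) (trans (ℤ.pos-+ m n) (sym (cong₂ ℤ._+_ (ℤ.*-identityʳ (ℤ.+ m)) (ℤ.*-identityʳ (ℤ.+ n)))))

toℚ-homo-* : ∀ m n → toℚ (m ℕ.* n) ≡ toℚ m * toℚ n
toℚ-homo-* m n rewrite toℚ≡mkℚ m | toℚ≡mkℚ n = cong (λ x → x ℚ./ 1) (ℤ.pos-* m n)

x*[1+n]≡0⇒x≡0 : ∀ x n → x * toℚ (suc n) ≡ 0ℚ → x ≡ 0ℚ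
x*[1+n]≡0⇒x≡0 x n x*q≡0 rewrite toℚ≡mkℚ (suc n) = begin
  x                ≡⟨ ℚ.*-identityʳ x ⟨
  x * 1ℚ           ≡⟨ cong (x *_) (ℚ.*-inverseʳ q) ⟨
  x * (q * ℚ.1/ q) ≡⟨ ℚ.*-assoc x q (ℚ.1/ q) ⟨
  x * q * ℚ.1/ q   ≡⟨ cong (_* ℚ.1/ q) x*q≡0 ⟩
  0ℚ * ℚ.1/ q      ≡⟨ ℚ.*-zeroˡ (ℚ.1/ q) ⟩
  0ℚ               ∎
  where q = mkℚ (ℤ.+ suc n) 0 _

sumℚ-cong : ∀ L {f g : ℕ → ℚ} → (∀ j → f j ≡ g j) → sumℚ L f ≡ sumℚ L g
sumℚ-cong zero    f≗g = refl
sumℚ-cong (suc L) f≗g = cong₂ _+_ (sumℚ-cong L f≗g) (f≗g L)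

sumℚ-+ : ∀ L (f g : ℕ → ℚ) → sumℚ L (λ j → f j + g j) ≡ sumℚ L f + sumℚ L g
sumℚ-+ zero    f g = sym (ℚ.+-identityˡ 0ℚ)
sumℚ-+ (suc L) f g = trans (cong (_+ (f L + g L)) (sumℚ-+ L f g)) (medial (sumℚ L f) (sumℚ L g) (f L) (g L))
  where
  medial : ∀ a b c d → a + b + (c + d) ≡ a + c + (b + d)
  medial = solve 4 (λ a b c d → a :+ b :+ (c :+ d) := a :+ c :+ (b :+ d)) refl

sumℚ-- : ∀ L (f g : ℕ → ℚ) → sumℚ L (λ j → f j - g j) ≡ sumℚ L f - sumℚ L g
sumℚ-- zero    f g = sym (ℚ.+-inverseʳ 0ℚ)
sumℚ-- (suc L) f g = trans (cong (_+ (f L - g L)) (sumℚ-- L f g)) (medial (sumℚ L f) (sumℚ L g) (f L) (g L))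
  where
  medial : ∀ a b c d → a - b + (c - d) ≡ a + c - (b + d)
  medial = solve 4 (λ a b c d → a :- b :+ (c :- d) := a :+ c :- (b :+ d)) refl

sumℚ-*ˡ : ∀ L a (f : ℕ → ℚ) → sumℚ L (λ j → a * f j) ≡ a * sumℚ L f
sumℚ-*ˡ zero    a f = sym (ℚ.*-zeroʳ a)
sumℚ-*ˡ (suc L) a f = trans (cong (_+ a * f L) (sumℚ-*ˡ L a f)) (sym (ℚ.*-distribˡ-+ a (sumℚ L f) (f L)))

sumℚ-*ʳ : ∀ L a (f : ℕ → ℚ) → sumℚ L (λ j → f j * a) ≡ sumℚ L f * a
sumℚ-*ʳ zero    a f = sym (ℚ.*-zeroˡ a)
sumℚ-*ʳ (suc L) a f = trans (cong (_+ f L * a) (sumℚ-*ʳ L a f)) (sym (ℚ.*-distribʳ-+ a (sumℚ L f) (f L)))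

sumℚ-first : ∀ L (f : ℕ → ℚ) → sumℚ (suc L) f ≡ f 0 + sumℚ L (λ j → f (suc j))
sumℚ-first zero    f = ℚ.+-comm 0ℚ (f 0)
sumℚ-first (suc L) f = trans (cong (_+ f (suc L)) (sumℚ-first L f)) (ℚ.+-assoc (f 0) _ (f (suc L)))

backwardDifference : ℚ → (ℕ → ℚ) → ℕ → ℚ
backwardDifference s a zero    = s - a 0
backwardDifference s a (suc j) = a j - a (suc j)

summation-by-parts : ∀ L s (a b : ℕ → ℚ) →
  s * b 0 + sumℚ L (λ j → a j * (b (suc j) - b j))
    ≡ sumℚ (suc L) (λ j → backwardDifference s a j * b j) + a L * b L
summation-by-parts zero    s a b = base s (a 0) (b 0)
  where
  base : ∀ s a b → s * b + 0ℚ ≡ 0ℚ + (s - a) * b + a * b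
  base = solve 3 (λ s a b → s :* b :+ con 0ℚ := con 0ℚ :+ (s :- a) :* b :+ a :* b) refl
summation-by-parts (suc L) s a b = begin
  s * b 0 + (sumℚ L g + a L * (b (suc L) - b L))
    ≡⟨ ℚ.+-assoc (s * b 0) _ _ ⟨
  s * b 0 + sumℚ L g + a L * (b (suc L) - b L)
    ≡⟨ cong (_+ a L * (b (suc L) - b L)) (summation-by-parts L s a b) ⟩
  sumℚ (suc L) h + a L * b L + a L * (b (suc L) - b L)
    ≡⟨ step (sumℚ (suc L) h) (a L) (a (suc L)) (b L) (b (suc L)) ⟩
  sumℚ (suc L) h + (a L - a (suc L)) * b (suc L) + a (suc L) * b (suc L)
    ∎
  where
  g = λ j → a j * (b (suc j) - b j)
  h = λ j → backwardDifference s a j * b j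
  step : ∀ x a a′ b b′ → x + a * b + a * (b′ - b) ≡ x + (a - a′) * b′ + a′ * b′
  step = solve 5 (λ x a a′ b b′ → x :+ a :* b :+ a :* (b′ :- b) := x :+ (a :- a′) :* b′ :+ a′ :* b′) refl

ψ-mul-n : ∀ j t → toℚ (suc t) * toℚ (ψ (suc (suc j)) (suc t))
  ≡ toℚ (ψ 2 (suc t)) + toℚ (suc j) * (toℚ (ψ (suc (suc (suc j))) (suc t)) - toℚ (ψ (suc (suc j)) (suc t)))
ψ-mul-n j t = begin
  n * x               ≡⟨ split n k x ⟩
  (n + k) * x - k * x ≡⟨ cong (_- k * x) recurrence ⟩
  s + k * y - k * x   ≡⟨ collect s k y x ⟩
  s + k * (y - x)     ∎
  where
  n = toℚ (suc t)
  k = toℚ (suc j)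
  s = toℚ (ψ 2 (suc t))
  x = toℚ (ψ (suc (suc j)) (suc t))
  y = toℚ (ψ (suc (suc (suc j))) (suc t))
  recurrence : (n + k) * x ≡ s + k * y
  recurrence = begin
    (n + k) * x
      ≡⟨ cong (_* x) (toℚ-homo-+ (suc t) (suc j)) ⟨
    toℚ (suc t ℕ.+ suc j) * x
      ≡⟨ toℚ-homo-* (suc t ℕ.+ suc j) (ψ (suc (suc j)) (suc t)) ⟨
    toℚ ((suc t ℕ.+ suc j) ℕ.* ψ (suc (suc j)) (suc t))
      ≡⟨ cong toℚ (ψ-recurrence (suc j) t) ⟩
    toℚ (suc t ℕ.* suc t ℕ.+ suc j ℕ.* ψ (suc (suc (suc j))) (suc t))
      ≡⟨ toℚ-homo-+ (suc t ℕ.* suc t) (suc j ℕ.* ψ (suc (suc (suc j))) (suc t)) ⟩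
    toℚ (suc t ℕ.* suc t) + toℚ (suc j ℕ.* ψ (suc (suc (suc j))) (suc t))
      ≡⟨ cong₂ _+_ (cong toℚ (sym (ψ-two t))) (toℚ-homo-* (suc j) (ψ (suc (suc (suc j))) (suc t))) ⟩
    s + k * y
      ∎
  split : ∀ n k x → n * x ≡ (n + k) * x - k * x
  split = solve 3 (λ n k x → n :* x := (n :+ k) :* x :- k :* x) refl
  collect : ∀ s k y x → s + k * y - k * x ≡ s + k * (y - x)
  collect = solve 4 (λ s k y x → s :+ k :* y :- k :* x := s :+ k :* (y :- x)) refl

-- ψ-coefficients p j is the coefficient c_{p+2, j+2}; the recursion is ψ-mul-n followed by summation by parts.
ψ-coefficients : ℕ → ℕ → ℚ
ψ-coefficients zero    zero    = 1ℚ
ψ-coefficients zero    (suc j) = 0ℚ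
ψ-coefficients (suc p) j       =
  backwardDifference (sumℚ (suc p) (ψ-coefficients p)) (λ i → toℚ (suc i) * ψ-coefficients p i) j

ψ-coefficients-vanish : ∀ p j → p < j → ψ-coefficients p j ≡ 0ℚ
ψ-coefficients-vanish zero    (suc j) _         = refl
ψ-coefficients-vanish (suc p) (suc j) (s≤s p<j) = begin
  toℚ (suc j) * ψ-coefficients p j - toℚ (suc (suc j)) * ψ-coefficients p (suc j)
    ≡⟨ cong₂ (λ x y → toℚ (suc j) * x - toℚ (suc (suc j)) * y)
             (ψ-coefficients-vanish p j p<j) (ψ-coefficients-vanish p (suc j) (ℕ.m<n⇒m<1+n p<j)) ⟩
  toℚ (suc j) * 0ℚ - toℚ (suc (suc j)) * 0ℚ
    ≡⟨ cong₂ _-_ (ℚ.*-zeroʳ (toℚ (suc j))) (ℚ.*-zeroʳ (toℚ (suc (suc j)))) ⟩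
  0ℚ
    ∎

ψ-coefficients-represent : ∀ p → Represents (suc (suc p)) (λ k → ψ-coefficients p (k ℕ.∸ 2))
ψ-coefficients-represent zero    (suc t) _ = begin
  toℚ (suc t ℕ.* (suc t ℕ.* 1)) ≡⟨ cong (λ x → toℚ (suc t ℕ.* x)) (ℕ.*-identityʳ (suc t)) ⟩
  toℚ (suc t ℕ.* suc t)         ≡⟨ cong toℚ (ψ-two t) ⟨
  toℚ (ψ 2 (suc t))             ≡⟨ trans (ℚ.+-identityˡ _) (ℚ.*-identityˡ _) ⟨
  0ℚ + 1ℚ * toℚ (ψ 2 (suc t))   ∎
ψ-coefficients-represent (suc p) (suc t) _ = begin
  toℚ (suc t ℕ.* suc t ℕ.^ suc (suc p))
    ≡⟨ toℚ-homo-* (suc t) (suc t ℕ.^ suc (suc p)) ⟩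
  n * toℚ (suc t ℕ.^ suc (suc p))
    ≡⟨ cong (n *_) (ψ-coefficients-represent p (suc t) (s≤s z≤n)) ⟩
  n * sumℚ (suc p) (λ j → c j * b j)
    ≡⟨ sumℚ-*ˡ (suc p) n _ ⟨
  sumℚ (suc p) (λ j → n * (c j * b j))
    ≡⟨ sumℚ-cong (suc p) multiply ⟩
  sumℚ (suc p) (λ j → c j * b 0 + a j * (b (suc j) - b j))
    ≡⟨ sumℚ-+ (suc p) _ _ ⟩
  sumℚ (suc p) (λ j → c j * b 0) + sumℚ (suc p) (λ j → a j * (b (suc j) - b j))
    ≡⟨ cong (_+ sumℚ (suc p) (λ j → a j * (b (suc j) - b j))) (sumℚ-*ʳ (suc p) (b 0) c) ⟩
  sumℚ (suc p) c * b 0 + sumℚ (suc p) (λ j → a j * (b (suc j) - b j))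
    ≡⟨ summation-by-parts (suc p) (sumℚ (suc p) c) a b ⟩
  sumℚ (suc (suc p)) (λ j → ψ-coefficients (suc p) j * b j) + a (suc p) * b (suc p)
    ≡⟨ cong (sumℚ (suc (suc p)) (λ j → ψ-coefficients (suc p) j * b j) +_) top-term ⟩
  sumℚ (suc (suc p)) (λ j → ψ-coefficients (suc p) j * b j) + 0ℚ
    ≡⟨ ℚ.+-identityʳ _ ⟩
  sumℚ (suc (suc p)) (λ j → ψ-coefficients (suc p) j * b j)
    ∎
  where
  n = toℚ (suc t)
  c = ψ-coefficients p
  a = λ j → toℚ (suc j) * c j
  b = λ j → toℚ (ψ (suc (suc j)) (suc t))
  multiply : ∀ j → n * (c j * b j) ≡ c j * b 0 + a j * (b (suc j) - b j)
  multiply j = begin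
    n * (c j * b j)                               ≡⟨ swap n (c j) (b j) ⟩
    c j * (n * b j)                               ≡⟨ cong (c j *_) (ψ-mul-n j t) ⟩
    c j * (b 0 + toℚ (suc j) * (b (suc j) - b j)) ≡⟨ expand (c j) (b 0) (toℚ (suc j)) (b (suc j) - b j) ⟩
    c j * b 0 + a j * (b (suc j) - b j)           ∎
    where
    swap : ∀ n c x → n * (c * x) ≡ c * (n * x)
    swap = solve 3 (λ n c x → n :* (c :* x) := c :* (n :* x)) refl
    expand : ∀ c s k d → c * (s + k * d) ≡ c * s + k * c * d
    expand = solve 4 (λ c s k d → c :* (s :+ k :* d) := c :* s :+ k :* c :* d) refl
  top-term : a (suc p) * b (suc p) ≡ 0ℚ
  top-term = begin
    toℚ (suc (suc p)) * c (suc p) * b (suc p)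
      ≡⟨ cong (λ x → toℚ (suc (suc p)) * x * b (suc p)) (ψ-coefficients-vanish p (suc p) (ℕ.n<1+n p)) ⟩
    toℚ (suc (suc p)) * 0ℚ * b (suc p)
      ≡⟨ cong (_* b (suc p)) (ℚ.*-zeroʳ (toℚ (suc (suc p)))) ⟩
    0ℚ * b (suc p)
      ≡⟨ ℚ.*-zeroˡ (b (suc p)) ⟩
    0ℚ
      ∎

multichooseSum : ℕ → (ℕ → ℚ) → ℕ → ℚ
multichooseSum M f t = sumℚ M (λ i → f i * toℚ (multichoose t i))

multichooseSum-Δ : ∀ M f t →
  multichooseSum (suc M) f (suc t) ≡ multichooseSum (suc M) f t + multichooseSum M (λ i → f (suc i)) (suc t)
multichooseSum-Δ M f t = begin
  multichooseSum (suc M) f (suc t)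
    ≡⟨ sumℚ-first M _ ⟩
  f 0 * 1ℚ + sumℚ M (λ i → f (suc i) * toℚ (multichoose (suc t) (suc i)))
    ≡⟨ cong (f 0 * 1ℚ +_) (trans (sumℚ-cong M pascal) (sumℚ-+ M _ _)) ⟩
  f 0 * 1ℚ + (sumℚ M (λ i → f (suc i) * toℚ (multichoose t (suc i))) + δ)
    ≡⟨ ℚ.+-assoc (f 0 * 1ℚ) _ δ ⟨
  f 0 * 1ℚ + sumℚ M (λ i → f (suc i) * toℚ (multichoose t (suc i))) + δ
    ≡⟨ cong (_+ δ) (sumℚ-first M _) ⟨
  multichooseSum (suc M) f t + δ
    ∎
  where
  δ = multichooseSum M (λ i → f (suc i)) (suc t)
  pascal : ∀ i → f (suc i) * toℚ (multichoose (suc t) (suc i))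
                 ≡ f (suc i) * toℚ (multichoose t (suc i)) + f (suc i) * toℚ (multichoose (suc t) i)
  pascal i = begin
    f (suc i) * toℚ (multichoose (suc t) (suc i))
      ≡⟨ cong (λ x → f (suc i) * toℚ x) (multichoose-pascal t i) ⟩
    f (suc i) * toℚ (multichoose t (suc i) ℕ.+ multichoose (suc t) i)
      ≡⟨ cong (f (suc i) *_) (toℚ-homo-+ (multichoose t (suc i)) (multichoose (suc t) i)) ⟩
    f (suc i) * (toℚ (multichoose t (suc i)) + toℚ (multichoose (suc t) i))
      ≡⟨ ℚ.*-distribˡ-+ (f (suc i)) _ _ ⟩
    f (suc i) * toℚ (multichoose t (suc i)) + f (suc i) * toℚ (multichoose (suc t) i)
      ∎

multichooseSum-top : ∀ M f s → (∀ t → s ≤ t → multichooseSum (suc M) f t ≡ 0ℚ) → f M ≡ 0ℚ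
multichooseSum-top zero    f s vanish =
  trans (sym (trans (ℚ.+-identityˡ _) (ℚ.*-identityʳ (f 0)))) (vanish s ℕ.≤-refl)
multichooseSum-top (suc M) f s vanish = multichooseSum-top M (λ i → f (suc i)) (suc s) difference-vanishes
  where
  difference-vanishes : ∀ t → suc s ≤ t → multichooseSum (suc M) (λ i → f (suc i)) t ≡ 0ℚ
  difference-vanishes (suc u) (s≤s s≤u) = begin
    δ                                      ≡⟨ ℚ.+-identityˡ δ ⟨
    0ℚ + δ                                 ≡⟨ cong (_+ δ) (vanish u s≤u) ⟨
    multichooseSum (suc (suc M)) f u + δ   ≡⟨ multichooseSum-Δ (suc M) f u ⟨
    multichooseSum (suc (suc M)) f (suc u) ≡⟨ vanish (suc u) (ℕ.m≤n⇒m≤1+n s≤u) ⟩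
    0ℚ                                     ∎
    where δ = multichooseSum (suc M) (λ i → f (suc i)) (suc u)

multichoose-independent : ∀ M f s → (∀ t → s ≤ t → multichooseSum M f t ≡ 0ℚ) → ∀ i → i < M → f i ≡ 0ℚ
multichoose-independent (suc M) f s vanish i i<1+M with ℕ.m<1+n⇒m<n∨m≡n i<1+M
... | inj₂ refl = multichooseSum-top M f s vanish
... | inj₁ i<M  = multichoose-independent M f s truncation-vanishes i i<M
  where
  truncation-vanishes : ∀ t → s ≤ t → multichooseSum M f t ≡ 0ℚ
  truncation-vanishes t s≤t = begin
    multichooseSum M f t                               ≡⟨ ℚ.+-identityʳ _ ⟨
    multichooseSum M f t + 0ℚ                          ≡⟨ cong (multichooseSum M f t +_) top-term ⟨
    multichooseSum M f t + f M * toℚ (multichoose t M) ≡⟨ vanish t s≤t ⟩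
    0ℚ                                                 ∎
    where
    top-term : f M * toℚ (multichoose t M) ≡ 0ℚ
    top-term = trans (cong (_* toℚ (multichoose t M)) (multichooseSum-top M f s vanish)) (ℚ.*-zeroˡ (toℚ (multichoose t M)))

ψ-independent : ∀ L (e : ℕ → ℚ) → (∀ t → sumℚ L (λ j → e j * toℚ (ψ (suc (suc j)) (suc t))) ≡ 0ℚ) →
                ∀ j → j < L → e j ≡ 0ℚ
ψ-independent L e vanish j j<L = x*[1+n]≡0⇒x≡0 (e j) (j ℕ.+ suc j ℕ.* suc j)
  (multichoose-independent (suc (suc L)) f 0 (λ t _ → trans (sym (expansion t)) (vanish t)) (suc (suc j)) (s≤s (s≤s j<L)))
  where
  E = sumℚ L e
  f : ℕ → ℚ
  f zero          = E
  f (suc zero)    = E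
  f (suc (suc i)) = e i * toℚ (suc (suc i) ℕ.* suc i)
  T : ℕ → ℚ
  T t = sumℚ L (λ i → f (suc (suc i)) * toℚ (multichoose t (suc (suc i))))
  split : ∀ t i → e i * toℚ (ψ (suc (suc i)) (suc t))
                  ≡ e i * toℚ (suc t) + f (suc (suc i)) * toℚ (multichoose t (suc (suc i)))
  split t i = begin
    e i * toℚ (ψ (suc (suc i)) (suc t))     ≡⟨ cong (λ x → e i * toℚ x) (ψ-multichoose (suc i) t) ⟩
    e i * toℚ (suc t ℕ.+ K ℕ.* R)           ≡⟨ cong (e i *_) (toℚ-homo-+ (suc t) (K ℕ.* R)) ⟩
    e i * (toℚ (suc t) + toℚ (K ℕ.* R))     ≡⟨ cong (λ x → e i * (toℚ (suc t) + x)) (toℚ-homo-* K R) ⟩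
    e i * (toℚ (suc t) + toℚ K * toℚ R)     ≡⟨ distribute (e i) (toℚ (suc t)) (toℚ K) (toℚ R) ⟩
    e i * toℚ (suc t) + e i * toℚ K * toℚ R ∎
    where
    K = suc (suc i) ℕ.* suc i
    R = multichoose t (suc (suc i))
    distribute : ∀ e a k r → e * (a + k * r) ≡ e * a + e * k * r
    distribute = solve 4 (λ e a k r → e :* (a :+ k :* r) := e :* a :+ e :* k :* r) refl
  expansion : ∀ t → sumℚ L (λ i → e i * toℚ (ψ (suc (suc i)) (suc t))) ≡ multichooseSum (suc (suc L)) f t
  expansion t = begin
    sumℚ L (λ i → e i * toℚ (ψ (suc (suc i)) (suc t)))
      ≡⟨ trans (sumℚ-cong L (split t)) (sumℚ-+ L _ _) ⟩
    sumℚ L (λ i → e i * toℚ (suc t)) + T t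
      ≡⟨ cong (_+ T t) (sumℚ-*ʳ L (toℚ (suc t)) e) ⟩
    E * toℚ (suc t) + T t
      ≡⟨ cong (λ x → E * x + T t) (toℚ-homo-+ 1 t) ⟩
    E * (1ℚ + toℚ t) + T t
      ≡⟨ cong (λ x → E * (1ℚ + toℚ x) + T t) multichoose-one ⟨
    E * (1ℚ + toℚ (multichoose t 1)) + T t
      ≡⟨ regroup E 1ℚ (toℚ (multichoose t 1)) (T t) ⟩
    E * 1ℚ + (E * toℚ (multichoose t 1) + T t)
      ≡⟨ trans (sumℚ-first (suc L) _) (cong (E * 1ℚ +_) (sumℚ-first L _)) ⟨
    multichooseSum (suc (suc L)) f t
      ∎
    where
    multichoose-one : multichoose t 1 ≡ t
    multichoose-one = trans (nC1≡n (t ℕ.+ 0)) (ℕ.+-identityʳ t)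
    regroup : ∀ e a b x → e * (a + b) + x ≡ e * a + (e * b + x)
    regroup = solve 4 (λ e a b x → e :* (a :+ b) :+ x := e :* a :+ (e :* b :+ x)) refl

ψ-representation-unique : ∀ m c d → Represents m c → Represents m d → ∀ k → 2 ≤ k → k ≤ m → d k ≡ c k
ψ-representation-unique (suc m) c d rep-c rep-d (suc (suc j)) (s≤s (s≤s z≤n)) (s≤s j<m) =
  x∙y⁻¹≈ε⇒x≈y (d (suc (suc j))) (c (suc (suc j))) (ψ-independent m e difference-vanishes j j<m)
  where
  e = λ i → d (suc (suc i)) - c (suc (suc i))
  x = λ t i → toℚ (ψ (suc (suc i)) (suc t))
  difference-vanishes : ∀ t → sumℚ m (λ i → e i * x t i) ≡ 0ℚ
  difference-vanishes t = begin
    sumℚ m (λ i → e i * x t i)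
      ≡⟨ sumℚ-cong m (λ i → distribute (d (suc (suc i))) (c (suc (suc i))) (x t i)) ⟩
    sumℚ m (λ i → d (suc (suc i)) * x t i - c (suc (suc i)) * x t i)
      ≡⟨ sumℚ-- m _ _ ⟩
    sumℚ m (λ i → d (suc (suc i)) * x t i) - sumℚ m (λ i → c (suc (suc i)) * x t i)
      ≡⟨ cong₂ _-_ (rep-d (suc t) (s≤s z≤n)) (rep-c (suc t) (s≤s z≤n)) ⟨
    toℚ (suc t ℕ.^ suc m) - toℚ (suc t ℕ.^ suc m)
      ≡⟨ ℚ.+-inverseʳ (toℚ (suc t ℕ.^ suc m)) ⟩
    0ℚ
      ∎
    where
    distribute : ∀ d c x → (d - c) * x ≡ d * x - c * x
    distribute = solve 3 (λ d c x → (d :- c) :* x := d :* x :- c :* x) refl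

sumTo-linear : ∀ L (c : ℕ → ℚ) (F : ℕ → ℕ) (G : ℕ → ℕ → ℕ) →
  (∀ n → 1 ≤ n → toℚ (F n) ≡ sumℚ L (λ j → c j * toℚ (G j n))) →
  ∀ n → toℚ (sumTo F n) ≡ sumℚ L (λ j → c j * toℚ (sumTo (G j) n))
sumTo-linear L c F G F≡ zero    = sym (trans (sumℚ-*ʳ L 0ℚ c) (ℚ.*-zeroʳ (sumℚ L c)))
sumTo-linear L c F G F≡ (suc n) = begin
  toℚ (sumTo F n ℕ.+ F (suc n))
    ≡⟨ toℚ-homo-+ (sumTo F n) (F (suc n)) ⟩
  toℚ (sumTo F n) + toℚ (F (suc n))
    ≡⟨ cong₂ _+_ (sumTo-linear L c F G F≡ n) (F≡ (suc n) (s≤s z≤n)) ⟩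
  sumℚ L (λ j → c j * toℚ (sumTo (G j) n)) + sumℚ L (λ j → c j * toℚ (G j (suc n)))
    ≡⟨ sumℚ-+ L _ _ ⟨
  sumℚ L (λ j → c j * toℚ (sumTo (G j) n) + c j * toℚ (G j (suc n)))
    ≡⟨ sumℚ-cong L collect ⟩
  sumℚ L (λ j → c j * toℚ (sumTo (G j) (suc n)))
    ∎
  where
  collect : ∀ j → c j * toℚ (sumTo (G j) n) + c j * toℚ (G j (suc n)) ≡ c j * toℚ (sumTo (G j) (suc n))
  collect j = sym (trans (cong (c j *_) (toℚ-homo-+ (sumTo (G j) n) (G j (suc n)))) (ℚ.*-distribˡ-+ (c j) _ _))

iterated-representation : ∀ m c → Represents m c →
  ∀ a n → 1 ≤ n → toℚ (S a m n) ≡ Σ₂ m (λ k → c k * toℚ (ψIter a k n))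
iterated-representation m c rep zero        = rep
iterated-representation m c rep (suc a) n _ =
  sumTo-linear (m ℕ.∸ 1) (λ j → c (suc (suc j))) (S a m) (λ j → ψIter a (suc (suc j)))
    (iterated-representation m c rep a) n

mainTheorem1 : (m : ℕ) → 2 ≤ m →
    ∃ λ (c : ℕ → ℚ) →
      Represents m c
      × (∀ (d : ℕ → ℚ) → Represents m d → ∀ k → 2 ≤ k → k ≤ m → d k ≡ c k)
      × (∀ (a n : ℕ) → 1 ≤ a → 1 ≤ n →
          toℚ (S a m n) ≡ Σ₂ m (λ k → c k *ℚ toℚ (ψIter a k n)))
mainTheorem1 m@(suc (suc p)) (s≤s (s≤s z≤n)) =
  c , represents , (λ d → ψ-representation-unique m c d represents) , (λ a n _ → iterated-representation m c represents a n)
  where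
  c : ℕ → ℚ
  c k = ψ-coefficients p (k ℕ.∸ 2)
  represents : Represents m c
  represents = ψ-coefficients-represent p
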